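{- Let $F$ be a field and $n\ge 0$. For $p\in V_n$ define $S(p)(x) = p(x^2)$ and $T(p)(x) = x^n p(x+x^{ -1})$. Then the following maps are well-defined $F$-linear isomorphisms: $S\colon V_n \to U_{2n}$, $S|_{W_n}\colon W_n \to W_{2n}\cap U_{2n}$, $T\colon V_n\to W_{2n}$, and $T|_{U_n}\colon U_n \to W_{2n}\cap U_{2n}$.
   Context: $V_n$ denotes the $F$-vector space of polynomials in $F[x]$ of degree at most $n$. $W_n = \{c_0x^n + c_1x^{n-1}+\dots+c_n \in V_n : c_i = c_{n-i} \text{ for all } 0\le i\le n\}$ and $U_n = \{c_0x^n + c_1x^{n-1}+\dots+c_n\in V_n : c_i = 0 \text{ for all odd } i\}$ (coefficients indexed relative to $V_n$). -}

module Defs where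

import Level
open import Level using (Level; _⊔_) renaming (suc to lsuc)
open import Algebra.Bundles using (CommutativeRing)
open import Data.Nat as ℕ using (ℕ; zero; suc; _∸_; _<_)
open import Data.Nat.DivMod using (_%_)
open import Data.Unit using (⊤)
open import Relation.Binary.PropositionalEquality using (_≡_)
open import Data.Fin using (Fin; toℕ; opposite)
open import Data.List using (List; []; _∷_)
open import Data.Product using (Σ; _×_; _,_)
open import Relation.Nullary using (¬_)

record Field (c ℓ : Level) : Set (lsuc (c ⊔ ℓ)) where
  field
    commutativeRing : CommutativeRing c ℓ
  open CommutativeRing commutativeRing public
  field
    1≉0     : ¬ (1# ≈ 0#)
    inverse : ∀ x → ¬ (x ≈ 0#) → Σ Carrier λ y → (x * y) ≈ 1#

Odd : ℕ → Set
Odd k = k % 2 ≡ 1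

module Polys {c ℓ} (F : Field c ℓ) where
  open Field F

  -- Polynomials in F[x] as lists of coefficients, lowest degree first:
  -- a₀ ∷ a₁ ∷ … represents a₀ + a₁ x + a₂ x² + …
  Poly : Set c
  Poly = List Carrier

  coeff : Poly → ℕ → Carrier
  coeff []       k       = 0#
  coeff (a ∷ p)  zero    = a
  coeff (a ∷ p)  (suc k) = coeff p k

  infixl 6 _+P_
  infixl 7 _*P_ _·P_

  _+P_ : Poly → Poly → Poly
  []      +P q       = q
  (a ∷ p) +P []      = a ∷ p
  (a ∷ p) +P (b ∷ q) = (a + b) ∷ (p +P q)

  _·P_ : Carrier → Poly → Poly
  λ' ·P []      = []
  λ' ·P (a ∷ p) = (λ' * a) ∷ (λ' ·P p)

  _*P_ : Poly → Poly → Poly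
  []      *P q = []
  (a ∷ p) *P q = (a ·P q) +P (0# ∷ (p *P q))

  oneP : Poly
  oneP = 1# ∷ []

  X : Poly
  X = 0# ∷ 1# ∷ []

  _^P_ : Poly → ℕ → Poly
  p ^P zero  = oneP
  p ^P suc k = p *P (p ^P k)

  _∘P_ : Poly → Poly → Poly
  []      ∘P q = []
  (a ∷ p) ∘P q = (a ∷ []) +P (q *P (p ∘P q))

  sumP : (n : ℕ) → (Fin (suc n) → Poly) → Poly
  sumP zero    f = f Fin.zero
  sumP (suc n) f = f Fin.zero +P sumP n (λ i → f (Fin.suc i))

  -- An element of V_n, given by its coefficient vector (c_0,…,c_n) in the
  -- paper's indexing: it represents c_0 x^n + c_1 x^{n-1} + … + c_n.
  V : ℕ → Set c
  V n = Fin (suc n) → Carrier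

  toPoly : (n : ℕ) → V n → Poly
  toPoly n c = sumP n (λ i → c i ·P (X ^P (n ∸ toℕ i)))

  DegLe : ℕ → Poly → Set ℓ
  DegLe n p = ∀ k → n < k → coeff p k ≈ 0#

  fromPoly : (n : ℕ) → Poly → V n
  fromPoly n p i = coeff p (n ∸ toℕ i)

  InW : (n : ℕ) → V n → Set ℓ
  InW n c = ∀ i → c i ≈ c (opposite i)

  InU : (n : ℕ) → V n → Set ℓ
  InU n c = ∀ i → Odd (toℕ i) → c i ≈ 0#

  InV : (n : ℕ) → V n → Set ℓ
  InV n c = Level.Lift ℓ ⊤

  S : Poly → Poly
  S p = p ∘P (X ^P 2)

  -- T(p)(x) = x^n p(x + x⁻¹).  For p = Σ_i c_i x^{n-i} this is
  -- x^n Σ_i c_i (x + x⁻¹)^{n-i} = Σ_i c_i x^i (x² + 1)^{n-i}.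
  T : (n : ℕ) → V n → Poly
  T n c = sumP n (λ i → c i ·P ((X ^P toℕ i) *P (((X ^P 2) +P oneP) ^P (n ∸ toℕ i))))

  _≈V_ : ∀ {n} → V n → V n → Set ℓ
  c ≈V d = ∀ i → c i ≈ d i

  _+V_ : ∀ {n} → V n → V n → V n
  (c +V d) i = c i + d i

  _·V_ : ∀ {n} → Carrier → V n → V n
  (a ·V c) i = a * c i

  -- f : A → B (A ⊆ V n, B ⊆ V m) given by a polynomial-valued map g on V n
  -- is a well-defined F-linear isomorphism from A onto B:
  --  * well-defined: for c ∈ A, g c has degree ≤ m and its coefficient
  --    vector lies in B;
  --  * F-linear (on A, which in all cases is a subspace);
  --  * injective on A and surjective onto B.
  IsLinIso : (n m : ℕ) (A : V n → Set ℓ) (B : V m → Set ℓ) (g : V n → Poly) → Set (c ⊔ ℓ)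
  IsLinIso n m A B g =
    (∀ x → A x → DegLe m (g x) × B (fromPoly m (g x)))
    × (∀ x y → A x → A y → fromPoly m (g (x +V y)) ≈V (fromPoly m (g x) +V fromPoly m (g y)))
    × (∀ a x → A x → fromPoly m (g (a ·V x)) ≈V (a ·V fromPoly m (g x)))
    × (∀ x y → A x → A y → fromPoly m (g x) ≈V fromPoly m (g y) → x ≈V y)
    × (∀ z → B z → Σ (V n) λ x → A x × fromPoly m (g x) ≈V z)

{-# OPTIONS --safe #-}
-- Everything is read off coefficient sequences, and only the ring structure of F is used.
-- S(p) = p(x²) spreads the coefficients of p onto the even positions, so S is a bijection from
-- V_n onto the polynomials of degree ≤ 2n with vanishing odd coefficients, and it maps
-- palindromes to palindromes. T sends x^(n-i) to x^i (1 + x²)^(n-i), a palindrome of degree 2n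
-- supported on positions of the parity of i. Only the i = 0 term has a constant coefficient, so
-- subtracting it and dividing by x reduces injectivity and surjectivity onto W_2n to the case
-- n - 1. The parity support shows that T maps U_n into U_2n, and the same induction shows that
-- a preimage of an element of U_2n lies in U_n.
module Submission where

open import Defs
open import Level using (Level; lift)
open import Algebra.Bundles using (Ring)
open import Data.Nat.Base as ℕ using (ℕ; zero; suc; _∸_; _<_; _≤_; s≤s; parity)
import Data.Nat.Properties as ℕₚ
open import Data.Parity.Base as ℙ using (Parity; 0ℙ; 1ℙ; _⁻¹)
import Data.Parity.Properties as ℙₚ
open import Data.Fin.Base using (Fin; zero; suc; toℕ; opposite; fromℕ<)
import Data.Fin.Properties as Finₚ
open import Data.Vec.Functional as Vec using (Vector; head; tail)
open import Data.List.Base using ([]; _∷_)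
open import Data.Product.Base using (Σ-syntax; _×_; _,_; proj₁; proj₂)
open import Data.Sum.Base using (_⊎_; inj₁; inj₂; [_,_]′)
open import Data.Empty using (⊥-elim)
open import Function.Base using (_∘_)
open import Relation.Binary.PropositionalEquality as ≡ using (_≡_; _≢_)
open import Relation.Nullary.Decidable using (yes; no)
import Relation.Binary.Reasoning.Setoid as SetoidReasoning

even⊎odd : ∀ k → (Σ[ j ∈ ℕ ] k ≡ 2 ℕ.* j) ⊎ (Σ[ j ∈ ℕ ] k ≡ suc (2 ℕ.* j))
even⊎odd zero          = inj₁ (0 , ≡.refl)
even⊎odd (suc zero)    = inj₂ (0 , ≡.refl)
even⊎odd (suc (suc k)) with even⊎odd k
... | inj₁ (j , k≡2j)   = inj₁ (suc j , ≡.trans (≡.cong (2 ℕ.+_) k≡2j) (≡.sym (ℕₚ.*-suc 2 j)))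
... | inj₂ (j , k≡1+2j) =
  inj₂ (suc j , ≡.trans (≡.cong (2 ℕ.+_) k≡1+2j) (≡.cong suc (≡.sym (ℕₚ.*-suc 2 j))))

parity-suc : ∀ k → parity (suc k) ≡ parity k ⁻¹
parity-suc k = ℙₚ.+-homo-+ 1 k

parity-even : ∀ j → parity (2 ℕ.* j) ≡ 0ℙ
parity-even j = ℙₚ.*-homo-* 2 j

parity-odd : ∀ j → parity (suc (2 ℕ.* j)) ≡ 1ℙ
parity-odd j = ≡.trans (parity-suc (2 ℕ.* j)) (≡.cong _⁻¹ (parity-even j))

≡⊎+1ℙ≡ : ∀ p q → q ≡ p ⊎ q ℙ.+ 1ℙ ≡ p
≡⊎+1ℙ≡ 0ℙ 0ℙ = inj₁ ≡.refl
≡⊎+1ℙ≡ 0ℙ 1ℙ = inj₂ ≡.refl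
≡⊎+1ℙ≡ 1ℙ 0ℙ = inj₂ ≡.refl
≡⊎+1ℙ≡ 1ℙ 1ℙ = inj₁ ≡.refl

+≡0ℙ⇒≡ : ∀ {p q} → p ℙ.+ q ≡ 0ℙ → p ≡ q
+≡0ℙ⇒≡ {0ℙ} {0ℙ} _ = ≡.refl
+≡0ℙ⇒≡ {1ℙ} {1ℙ} _ = ≡.refl

+≡2*⇒parity≡ : ∀ {a b n} → a ℕ.+ b ≡ 2 ℕ.* n → parity a ≡ parity b
+≡2*⇒parity≡ {a} {b} {n} a+b≡2n =
  +≡0ℙ⇒≡ (≡.trans (≡.sym (ℙₚ.+-homo-+ a b)) (≡.trans (≡.cong parity a+b≡2n) (parity-even n)))

parity-2n∸i : ∀ n (i : Fin (suc (2 ℕ.* n))) → parity (2 ℕ.* n ∸ toℕ i) ≡ parity (toℕ i)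
parity-2n∸i n i =
  +≡2*⇒parity≡ {2 ℕ.* n ∸ toℕ i} {toℕ i} {n} (ℕₚ.m∸n+n≡m (Finₚ.toℕ≤pred[n] i))

-- (suc (suc k)) % 2 reduces to k % 2, so Odd and parity follow the same recursion.
Odd⇒parity≡1ℙ : ∀ k → Odd k → parity k ≡ 1ℙ
Odd⇒parity≡1ℙ (suc zero)    _   = ≡.refl
Odd⇒parity≡1ℙ (suc (suc k)) odd = Odd⇒parity≡1ℙ k odd

parity≡1ℙ⇒Odd : ∀ k → parity k ≡ 1ℙ → Odd k
parity≡1ℙ⇒Odd (suc zero)    _ = ≡.refl
parity≡1ℙ⇒Odd (suc (suc k)) p = parity≡1ℙ⇒Odd k p

∸toℕ-onto : ∀ {m k} → k ≤ m → Σ[ i ∈ Fin (suc m) ] m ∸ toℕ i ≡ k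
∸toℕ-onto {m} {k} k≤m =
  opposite i , ≡.trans (≡.cong (m ∸_) toℕ-opposite) (ℕₚ.m∸[m∸n]≡n k≤m)
  where
  i = fromℕ< (s≤s k≤m)
  toℕ-opposite : toℕ (opposite i) ≡ m ∸ k
  toℕ-opposite = ≡.trans (Finₚ.opposite-prop i) (≡.cong (m ∸_) (Finₚ.toℕ-fromℕ< (s≤s k≤m)))

∸toℕ+∸toℕ-opposite : ∀ {m} (i : Fin (suc m)) → (m ∸ toℕ i) ℕ.+ (m ∸ toℕ (opposite i)) ≡ m
∸toℕ+∸toℕ-opposite {m} i =
  ≡.trans (≡.cong ((m ∸ toℕ i) ℕ.+_) m∸toℕ-opposite) (ℕₚ.m∸n+n≡m i≤m)
  where
  i≤m = Finₚ.toℕ≤pred[n] i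
  m∸toℕ-opposite : m ∸ toℕ (opposite i) ≡ toℕ i
  m∸toℕ-opposite = ≡.trans (≡.cong (m ∸_) (Finₚ.opposite-prop i)) (ℕₚ.m∸[m∸n]≡n i≤m)

module Sequences {c ℓ} (R : Ring c ℓ) where
  open Ring R hiding (zero)
  open import Algebra.Properties.Ring R using (+-cancelˡ; xyx⁻¹≈y)
  open import Algebra.Properties.Semiring.Sum semiring
    using (sum; sum-cong-≋; ∑-distrib-+; *-distribˡ-sum; sum-replicate-zero)
  open SetoidReasoning setoid

  Seq : Set c
  Seq = ℕ → Carrier

  infix 4 _≈ₛ_
  _≈ₛ_ : Seq → Seq → Set ℓ
  f ≈ₛ g = ∀ k → f k ≈ g k

  Degree≤ : ℕ → Seq → Set ℓ
  Degree≤ d f = ∀ k → d < k → f k ≈ 0#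

  Symmetric : ℕ → Seq → Set ℓ
  Symmetric d f = ∀ a b → a ℕ.+ b ≡ d → f a ≈ f b

  record Palindromic (d : ℕ) (f : Seq) : Set ℓ where
    field
      degree≤   : Degree≤ d f
      symmetric : Symmetric d f
  open Palindromic public

  VanishesAt : Parity → Seq → Set ℓ
  VanishesAt p f = ∀ k → parity k ≡ p → f k ≈ 0#

  +-preserves-≈0 : ∀ {x y} → x ≈ 0# → y ≈ 0# → x + y ≈ 0#
  +-preserves-≈0 x≈0 y≈0 = trans (+-cong x≈0 y≈0) (+-identityʳ 0#)

  Degree≤-mono : ∀ {d e f} → d ≤ e → Degree≤ d f → Degree≤ e f
  Degree≤-mono d≤e deg k e<k = deg k (ℕₚ.≤-<-trans d≤e e<k)

  symmetric-resp : ∀ {d f g} → f ≈ₛ g → Symmetric d f → Symmetric d g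
  symmetric-resp f≈g sym-f a b a+b≡d = trans (sym (f≈g a)) (trans (sym-f a b a+b≡d) (f≈g b))

  vanishesAt-resp : ∀ {p f g} → f ≈ₛ g → VanishesAt p f → VanishesAt p g
  vanishesAt-resp f≈g van k pk = trans (sym (f≈g k)) (van k pk)

  shift : Seq → Seq
  shift f zero    = 0#
  shift f (suc k) = f k

  shiftBy : ℕ → Seq → Seq
  shiftBy zero    f = f
  shiftBy (suc i) f = shift (shiftBy i f)

  shift-cong : ∀ {f g} → f ≈ₛ g → shift f ≈ₛ shift g
  shift-cong f≈g zero    = refl
  shift-cong f≈g (suc k) = f≈g k

  shiftBy-cong : ∀ i {f g} → f ≈ₛ g → shiftBy i f ≈ₛ shiftBy i g
  shiftBy-cong zero    f≈g = f≈g
  shiftBy-cong (suc i) f≈g = shift-cong (shiftBy-cong i f≈g)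

  shift-degree : ∀ {d f} → Degree≤ d f → Degree≤ (suc d) (shift f)
  shift-degree deg (suc k) (s≤s d<k) = deg k d<k

  shift-palindromic : ∀ {d f} → Palindromic d f → Palindromic (2 ℕ.+ d) (shift f)
  shift-palindromic {d} {f} pal = record
    { degree≤   = Degree≤-mono (ℕₚ.n≤1+n _) (shift-degree (degree≤ pal))
    ; symmetric = mirror
    }
    where
    mirror : Symmetric (2 ℕ.+ d) (shift f)
    mirror zero    (suc b) 1+b≡2+d =
      sym (degree≤ pal b (ℕₚ.≤-reflexive (≡.sym (ℕₚ.suc-injective 1+b≡2+d))))
    mirror (suc a) zero    a+0≡2+d = degree≤ pal a (ℕₚ.≤-reflexive (≡.sym a≡1+d))
      where a≡1+d = ≡.trans (≡.sym (ℕₚ.+-identityʳ a)) (ℕₚ.suc-injective a+0≡2+d)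
    mirror (suc a) (suc b) e       = symmetric pal a b
      (ℕₚ.suc-injective (≡.trans (≡.sym (ℕₚ.+-suc a b)) (ℕₚ.suc-injective e)))

  shiftBy-palindromic : ∀ i {d f} → Palindromic d f → Palindromic (2 ℕ.* i ℕ.+ d) (shiftBy i f)
  shiftBy-palindromic zero    pal = pal
  shiftBy-palindromic (suc i) {d} {f} pal =
    ≡.subst (λ e → Palindromic e (shiftBy (suc i) f)) (≡.cong (ℕ._+ d) (≡.sym (ℕₚ.*-suc 2 i)))
      (shift-palindromic (shiftBy-palindromic i pal))

  shift²-mirror : ∀ {d f} → Palindromic d f → ∀ a b → a ℕ.+ b ≡ 2 ℕ.+ d → shift (shift f) a ≈ f b
  shift²-mirror {d} pal zero       b b≡2+d   =
    sym (degree≤ pal b (≡.subst (d <_) (≡.sym b≡2+d) (ℕₚ.m<n⇒m<1+n (ℕₚ.n<1+n d))))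
  shift²-mirror {d} pal (suc zero) b 1+b≡2+d =
    sym (degree≤ pal b (≡.subst (d <_) (≡.sym (ℕₚ.suc-injective 1+b≡2+d)) (ℕₚ.n<1+n d)))
  shift²-mirror pal (suc (suc a)) b e      = symmetric pal a b (ℕₚ.suc-injective (ℕₚ.suc-injective e))

  unshift-palindromic : ∀ {d f} → Palindromic (2 ℕ.+ d) f → f 0 ≈ 0# → Palindromic d (f ∘ suc)
  unshift-palindromic {d} {f} pal f0≈0 = record
    { degree≤   = degree
    ; symmetric = λ a b a+b≡d → symmetric pal (suc a) (suc b)
                    (≡.cong suc (≡.trans (ℕₚ.+-suc a b) (≡.cong suc a+b≡d)))
    }
    where
    degree : Degree≤ d (f ∘ suc)
    degree k d<k with ℕₚ.m≤n⇒m<n∨m≡n (s≤s d<k)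
    ... | inj₁ 2+d<1+k = degree≤ pal (suc k) 2+d<1+k
    ... | inj₂ 2+d≡1+k =
      trans (symmetric pal (suc k) 0 (≡.trans (ℕₚ.+-identityʳ _) (≡.sym 2+d≡1+k))) f0≈0

  shift-vanishesAt : ∀ {p f} → VanishesAt p f → VanishesAt (p ⁻¹) (shift f)
  shift-vanishesAt van zero    _  = refl
  shift-vanishesAt van (suc k) pk = van k (ℙₚ.⁻¹-injective (≡.trans (≡.sym (parity-suc k)) pk))

  shift²-vanishesAt : ∀ {p f} → VanishesAt p f → VanishesAt p (shift (shift f))
  shift²-vanishesAt van zero          _  = refl
  shift²-vanishesAt van (suc zero)    _  = refl
  shift²-vanishesAt van (suc (suc k)) pk = van k pk

  shiftBy-vanishesAt : ∀ i {p f} → VanishesAt p f → VanishesAt (parity i ℙ.+ p) (shiftBy i f)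
  shiftBy-vanishesAt zero          van = van
  shiftBy-vanishesAt (suc zero)    van = shift-vanishesAt van
  shiftBy-vanishesAt (suc (suc i)) van = shift²-vanishesAt (shiftBy-vanishesAt i van)

  monomial : ℕ → Seq
  monomial zero    zero    = 1#
  monomial zero    (suc k) = 0#
  monomial (suc d)         = shift (monomial d)

  monomial-≡ : ∀ d → monomial d d ≈ 1#
  monomial-≡ zero    = refl
  monomial-≡ (suc d) = monomial-≡ d

  monomial-≢ : ∀ d k → k ≢ d → monomial d k ≈ 0#
  monomial-≢ zero    zero    k≢d = ⊥-elim (k≢d ≡.refl)
  monomial-≢ zero    (suc k) _   = refl
  monomial-≢ (suc d) zero    _   = refl
  monomial-≢ (suc d) (suc k) k≢d = monomial-≢ d k (k≢d ∘ ≡.cong suc)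

  monomial-degree : ∀ d → Degree≤ d (monomial d)
  monomial-degree d k d<k = monomial-≢ d k (ℕₚ.>⇒≢ d<k)

  sum-≈0 : ∀ {n} {t : Vector Carrier n} → (∀ i → t i ≈ 0#) → sum t ≈ 0#
  sum-≈0 {n} t≈0 = trans (sum-cong-≋ t≈0) (sum-replicate-zero n)

  combination : ∀ {n} → (Fin n → Seq) → Vector Carrier n → Seq
  combination E x k = sum (λ i → x i * E i k)

  combination-+ : ∀ {n} (E : Fin n → Seq) x y →
                  combination E (λ i → x i + y i) ≈ₛ λ k → combination E x k + combination E y k
  combination-+ E x y k = trans (sum-cong-≋ (λ i → distribʳ (E i k) (x i) (y i)))
                                (∑-distrib-+ (λ i → x i * E i k) (λ i → y i * E i k))

  combination-* : ∀ {n} (E : Fin n → Seq) a x →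
                  combination E (λ i → a * x i) ≈ₛ λ k → a * combination E x k
  combination-* E a x k = trans (sum-cong-≋ (λ i → *-assoc a (x i) (E i k)))
                                (sym (*-distribˡ-sum a (λ i → x i * E i k)))

  combination-shift : ∀ {n} (E : Fin n → Seq) x → combination (shift ∘ E) x ≈ₛ shift (combination E x)
  combination-shift E x zero    = sum-≈0 (λ i → zeroʳ (x i))
  combination-shift E x (suc k) = refl

  combination-degree : ∀ {n d} {E : Fin n → Seq} → (∀ i → Degree≤ d (E i)) →
                       ∀ x → Degree≤ d (combination E x)
  combination-degree deg x k d<k = sum-≈0 (λ i → trans (*-congˡ (deg i k d<k)) (zeroʳ (x i)))

  combination-palindromic : ∀ {n d} {E : Fin n → Seq} → (∀ i → Palindromic d (E i)) →
                            ∀ x → Palindromic d (combination E x)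
  combination-palindromic pal x = record
    { degree≤   = combination-degree (degree≤ ∘ pal) x
    ; symmetric = λ a b a+b≡d → sum-cong-≋ (λ i → *-congˡ (symmetric (pal i) a b a+b≡d))
    }

  combination-vanishesAt : ∀ {n p} {E : Fin n → Seq} x → (∀ i → x i ≈ 0# ⊎ VanishesAt p (E i)) →
                           VanishesAt p (combination E x)
  combination-vanishesAt x each k pk = sum-≈0 λ i →
    [ (λ xi≈0 → trans (*-congʳ xi≈0) (zeroˡ _))
    , (λ van → trans (*-congˡ (van k pk)) (zeroʳ (x i)))
    ]′ (each i)

  spread : Seq → Seq
  spread f zero          = f zero
  spread f (suc zero)    = 0#
  spread f (suc (suc k)) = spread (f ∘ suc) k

  evenPart : Seq → Seq
  evenPart f j = f (2 ℕ.* j)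

  spread-cong : ∀ {f g} → f ≈ₛ g → spread f ≈ₛ spread g
  spread-cong f≈g zero          = f≈g zero
  spread-cong f≈g (suc zero)    = refl
  spread-cong f≈g (suc (suc k)) = spread-cong (f≈g ∘ suc) k

  spread-even : ∀ f j → spread f (2 ℕ.* j) ≡ f j
  spread-even f zero    = ≡.refl
  spread-even f (suc j) = ≡.trans (≡.cong (spread f) (ℕₚ.*-suc 2 j)) (spread-even (f ∘ suc) j)

  spread-odd : ∀ f j → spread f (suc (2 ℕ.* j)) ≡ 0#
  spread-odd f zero    = ≡.refl
  spread-odd f (suc j) = ≡.trans (≡.cong (spread f ∘ suc) (ℕₚ.*-suc 2 j)) (spread-odd (f ∘ suc) j)

  spread-injective : ∀ {f g} → spread f ≈ₛ spread g → f ≈ₛ g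
  spread-injective {f} {g} sf≈sg j =
    ≡.subst₂ _≈_ (spread-even f j) (spread-even g j) (sf≈sg (2 ℕ.* j))

  spread-combination : ∀ {n} (E : Fin n → Seq) x →
                       spread (combination E x) ≈ₛ combination (spread ∘ E) x
  spread-combination E x zero          = refl
  spread-combination E x (suc zero)    = sym (sum-≈0 (λ i → zeroʳ (x i)))
  spread-combination E x (suc (suc k)) = spread-combination (λ i → E i ∘ suc) x k

  spread-vanishesAt : ∀ f → VanishesAt 1ℙ (spread f)
  spread-vanishesAt f (suc zero)    _  = refl
  spread-vanishesAt f (suc (suc k)) pk = spread-vanishesAt (f ∘ suc) k pk

  spread-degree : ∀ {n f} → Degree≤ n f → Degree≤ (2 ℕ.* n) (spread f)
  spread-degree {n} {f} deg k 2n<k with even⊎odd k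
  ... | inj₁ (j , ≡.refl) =
    ≡.subst (_≈ 0#) (≡.sym (spread-even f j)) (deg j (ℕₚ.*-cancelˡ-< 2 n j 2n<k))
  ... | inj₂ (j , ≡.refl) = reflexive (spread-odd f j)

  spread-symmetric : ∀ {n f} → Symmetric n f → Symmetric (2 ℕ.* n) (spread f)
  spread-symmetric {n} {f} sym-f a b a+b≡2n with even⊎odd a | even⊎odd b
  ... | inj₁ (i , ≡.refl) | inj₁ (j , ≡.refl) =
    ≡.subst₂ _≈_ (≡.sym (spread-even f i)) (≡.sym (spread-even f j))
      (sym-f i j (ℕₚ.*-cancelˡ-≡ _ _ 2 (≡.trans (ℕₚ.*-distribˡ-+ 2 i j) a+b≡2n)))
  ... | inj₂ (i , ≡.refl) | inj₂ (j , ≡.refl) =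
    reflexive (≡.trans (spread-odd f i) (≡.sym (spread-odd f j)))
  ... | inj₁ (i , ≡.refl) | inj₂ (j , ≡.refl)
    with () ← ≡.trans (≡.sym (parity-even i))
                (≡.trans (+≡2*⇒parity≡ {2 ℕ.* i} {suc (2 ℕ.* j)} {n} a+b≡2n) (parity-odd j))
  ... | inj₂ (i , ≡.refl) | inj₁ (j , ≡.refl)
    with () ← ≡.trans (≡.sym (parity-even j))
                (≡.trans (≡.sym (+≡2*⇒parity≡ {suc (2 ℕ.* i)} {2 ℕ.* j} {n} a+b≡2n)) (parity-odd i))

  spread-evenPart : ∀ {f} → VanishesAt 1ℙ f → spread (evenPart f) ≈ₛ f
  spread-evenPart {f} van k with even⊎odd k
  ... | inj₁ (j , ≡.refl) = reflexive (spread-even (evenPart f) j)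
  ... | inj₂ (j , ≡.refl) = trans (reflexive (spread-odd (evenPart f) j)) (sym (van _ (parity-odd j)))

  evenPart-degree : ∀ {n f} → Degree≤ (2 ℕ.* n) f → Degree≤ n (evenPart f)
  evenPart-degree deg j n<j = deg (2 ℕ.* j) (ℕₚ.*-monoʳ-< 2 n<j)

  evenPart-symmetric : ∀ {n f} → Symmetric (2 ℕ.* n) f → Symmetric n (evenPart f)
  evenPart-symmetric sym-f i j i+j≡n =
    sym-f (2 ℕ.* i) (2 ℕ.* j) (≡.trans (≡.sym (ℕₚ.*-distribˡ-+ 2 i j)) (≡.cong (2 ℕ.*_) i+j≡n))

  monomialBasis : (m : ℕ) → Fin (suc m) → Seq
  monomialBasis m = monomial ∘ (m ∸_) ∘ toℕ

  toSeq : (m : ℕ) → Vector Carrier (suc m) → Seq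
  toSeq m = combination (monomialBasis m)

  fromSeq : (m : ℕ) → Seq → Vector Carrier (suc m)
  fromSeq m f i = f (m ∸ toℕ i)

  toSeq-degree : ∀ m z → Degree≤ m (toSeq m z)
  toSeq-degree m = combination-degree (λ i → Degree≤-mono (ℕₚ.m∸n≤m m (toℕ i)) (monomial-degree _))

  fromSeq-toSeq : ∀ m z i → fromSeq m (toSeq m z) i ≈ z i
  fromSeq-toSeq zero    z zero    = trans (+-identityʳ _) (*-identityʳ _)
  fromSeq-toSeq (suc m) z zero    = begin
    head z * monomial (suc m) (suc m) + toSeq m (tail z) (suc m)
      ≈⟨ +-cong (*-congˡ (monomial-≡ m)) (toSeq-degree m (tail z) (suc m) (ℕₚ.n<1+n m)) ⟩
    head z * 1# + 0#  ≈⟨ +-identityʳ _ ⟩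
    head z * 1#       ≈⟨ *-identityʳ _ ⟩
    head z            ∎
  fromSeq-toSeq (suc m) z (suc i) = begin
    head z * monomial (suc m) (m ∸ toℕ i) + toSeq m (tail z) (m ∸ toℕ i)
      ≈⟨ +-cong (*-congˡ (monomial-≢ (suc m) _ m∸i≢1+m)) (fromSeq-toSeq m (tail z) i) ⟩
    head z * 0# + z (suc i)  ≈⟨ +-congʳ (zeroʳ _) ⟩
    0# + z (suc i)           ≈⟨ +-identityˡ _ ⟩
    z (suc i)                ∎
    where m∸i≢1+m = ℕₚ.<⇒≢ (s≤s (ℕₚ.m∸n≤m m (toℕ i)))

  toSeq-injective : ∀ m {x y} → toSeq m x ≈ₛ toSeq m y → ∀ i → x i ≈ y i
  toSeq-injective m {x} {y} x≈y i =
    trans (sym (fromSeq-toSeq m x i)) (trans (x≈y _) (fromSeq-toSeq m y i))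

  fromSeq-injective : ∀ {m f g} → Degree≤ m f → Degree≤ m g →
                      (∀ i → fromSeq m f i ≈ fromSeq m g i) → f ≈ₛ g
  fromSeq-injective {m} deg-f deg-g f≈g k with k ℕₚ.≤? m
  ... | no  k≰m = trans (deg-f k (ℕₚ.≰⇒> k≰m)) (sym (deg-g k (ℕₚ.≰⇒> k≰m)))
  ... | yes k≤m with ∸toℕ-onto k≤m
  ...   | i , ≡.refl = f≈g i

  toSeq-fromSeq : ∀ {m f} → Degree≤ m f → toSeq m (fromSeq m f) ≈ₛ f
  toSeq-fromSeq {m} {f} deg =
    fromSeq-injective (toSeq-degree m (fromSeq m f)) deg (fromSeq-toSeq m (fromSeq m f))

  evenBinomial : ℕ → Seq
  evenBinomial zero      = monomial 0
  evenBinomial (suc j) k = shift (shift (evenBinomial j)) k + evenBinomial j k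

  evenBinomial-0 : ∀ j → evenBinomial j 0 ≈ 1#
  evenBinomial-0 zero    = refl
  evenBinomial-0 (suc j) = trans (+-identityˡ _) (evenBinomial-0 j)

  evenBinomial-vanishesAt : ∀ j → VanishesAt 1ℙ (evenBinomial j)
  evenBinomial-vanishesAt zero    (suc k) _  = refl
  evenBinomial-vanishesAt (suc j) k       pk =
    +-preserves-≈0 (shift²-vanishesAt (evenBinomial-vanishesAt j) k pk) (evenBinomial-vanishesAt j k pk)

  evenBinomial-palindromic : ∀ j → Palindromic (2 ℕ.* j) (evenBinomial j)
  evenBinomial-palindromic zero = record
    { degree≤   = monomial-degree 0
    ; symmetric = λ { zero zero _ → refl }
    }
  evenBinomial-palindromic (suc j) =
    ≡.subst (λ d → Palindromic d (evenBinomial (suc j))) (≡.sym (ℕₚ.*-suc 2 j)) (record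
      { degree≤   = λ k 2+2j<k → +-preserves-≈0
                      (shift-degree (shift-degree (degree≤ pal)) k 2+2j<k)
                      (degree≤ pal k (ℕₚ.≤-<-trans (ℕₚ.m≤n+m _ 2) 2+2j<k))
      ; symmetric = λ a b a+b≡2+2j → trans
                      (+-cong (shift²-mirror pal a b a+b≡2+2j)
                              (sym (shift²-mirror pal b a (≡.trans (ℕₚ.+-comm b a) a+b≡2+2j))))
                      (+-comm _ _)
      })
    where pal = evenBinomial-palindromic j

  Tbasis : (n : ℕ) → Fin (suc n) → Seq
  Tbasis n i = shiftBy (toℕ i) (evenBinomial (n ∸ toℕ i))

  Tseq : (n : ℕ) → Vector Carrier (suc n) → Seq
  Tseq n = combination (Tbasis n)

  Tbasis-palindromic : ∀ n i → Palindromic (2 ℕ.* n) (Tbasis n i)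
  Tbasis-palindromic n i = ≡.subst (λ d → Palindromic d (Tbasis n i)) 2i+2[n∸i]≡2n
    (shiftBy-palindromic (toℕ i) (evenBinomial-palindromic (n ∸ toℕ i)))
    where
    2i+2[n∸i]≡2n : 2 ℕ.* toℕ i ℕ.+ 2 ℕ.* (n ∸ toℕ i) ≡ 2 ℕ.* n
    2i+2[n∸i]≡2n = ≡.trans (≡.sym (ℕₚ.*-distribˡ-+ 2 (toℕ i) _))
                           (≡.cong (2 ℕ.*_) (ℕₚ.m+[n∸m]≡n (Finₚ.toℕ≤pred[n] i)))

  Tseq-palindromic : ∀ n x → Palindromic (2 ℕ.* n) (Tseq n x)
  Tseq-palindromic n = combination-palindromic (Tbasis-palindromic n)

  Tseq-vanishesAt : ∀ {p} n x → (∀ i → parity (toℕ i) ≡ p → x i ≈ 0#) → VanishesAt p (Tseq n x)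
  Tseq-vanishesAt {p} n x x-vanishes = combination-vanishesAt x λ i →
    [ inj₁ ∘ x-vanishes i
    , (λ pi+1≡p → inj₂ (≡.subst (λ q → VanishesAt q (Tbasis n i)) pi+1≡p
                          (shiftBy-vanishesAt (toℕ i) (evenBinomial-vanishesAt (n ∸ toℕ i)))))
    ]′ (≡⊎+1ℙ≡ p (parity (toℕ i)))

  Tseq-suc : ∀ n x →
             Tseq (suc n) x ≈ₛ λ k → head x * evenBinomial (suc n) k + shift (Tseq n (tail x)) k
  Tseq-suc n x k = +-congˡ (combination-shift (Tbasis n) (tail x) k)

  Tseq-0 : ∀ n x → Tseq n x 0 ≈ head x
  Tseq-0 n x = begin
    Tseq n x 0                     ≈⟨ split n x ⟩
    head x * evenBinomial n 0 + 0# ≈⟨ +-identityʳ _ ⟩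
    head x * evenBinomial n 0      ≈⟨ *-congˡ (evenBinomial-0 n) ⟩
    head x * 1#                    ≈⟨ *-identityʳ _ ⟩
    head x                         ∎
    where
    split : ∀ n x → Tseq n x 0 ≈ head x * evenBinomial n 0 + 0#
    split zero    x = refl
    split (suc n) x = Tseq-suc n x 0

  Tseq-injective : ∀ n x y → Tseq n x ≈ₛ Tseq n y → ∀ i → x i ≈ y i
  Tseq-injective n       x y Tx≈Ty zero    = trans (sym (Tseq-0 n x)) (trans (Tx≈Ty 0) (Tseq-0 n y))
  Tseq-injective (suc n) x y Tx≈Ty (suc i) = Tseq-injective n (tail x) (tail y) tails≈ i
    where
    tails≈ : Tseq n (tail x) ≈ₛ Tseq n (tail y)
    tails≈ k = +-cancelˡ (head x * evenBinomial (suc n) (suc k)) _ _ (begin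
      head x * evenBinomial (suc n) (suc k) + Tseq n (tail x) k ≈⟨ Tx≈Ty (suc k) ⟩
      head y * evenBinomial (suc n) (suc k) + Tseq n (tail y) k ≈⟨ +-congʳ (*-congʳ (sym heads≈)) ⟩
      head x * evenBinomial (suc n) (suc k) + Tseq n (tail y) k ∎)
      where heads≈ = Tseq-injective (suc n) x y Tx≈Ty zero

  Tseq-surjective : ∀ n f → Palindromic (2 ℕ.* n) f → Σ[ x ∈ Vector Carrier (suc n) ] Tseq n x ≈ₛ f
  Tseq-surjective zero f pal =
    x , fromSeq-injective (degree≤ (Tseq-palindromic 0 x)) (degree≤ pal) λ { zero → Tseq-0 0 x }
    where
    x : Vector Carrier 1
    x _ = f 0
  Tseq-surjective (suc n) f pal = (a Vec.∷ y) , Ty≈f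
    where
    a = f 0
    B = evenBinomial (suc n)
    -- subtracting a (1 + x²)^(n+1) kills the constant term, hence by symmetry also the top one
    r : Seq
    r k = f k - a * B k
    r-palindromic : Palindromic (2 ℕ.* suc n) r
    r-palindromic = record
      { degree≤   = λ k 2n+2<k → trans
                      (+-cong (degree≤ pal k 2n+2<k)
                              (-‿cong (trans (*-congˡ (degree≤ B-palindromic k 2n+2<k)) (zeroʳ a))))
                      (-‿inverseʳ 0#)
      ; symmetric = λ i j i+j≡2n+2 → +-cong (symmetric pal i j i+j≡2n+2)
                                             (-‿cong (*-congˡ (symmetric B-palindromic i j i+j≡2n+2)))
      }
      where B-palindromic = evenBinomial-palindromic (suc n)
    r-0 : r 0 ≈ 0#
    r-0 = trans (+-congˡ (-‿cong (trans (*-congˡ (evenBinomial-0 (suc n))) (*-identityʳ a)))) (-‿inverseʳ a)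
    preimage = Tseq-surjective n (r ∘ suc)
      (unshift-palindromic (≡.subst (λ d → Palindromic d r) (ℕₚ.*-suc 2 n) r-palindromic) r-0)
    y = proj₁ preimage
    Ty≈f : Tseq (suc n) (a Vec.∷ y) ≈ₛ f
    Ty≈f zero    = Tseq-0 (suc n) (a Vec.∷ y)
    Ty≈f (suc k) = begin
      a * B (suc k) + Tseq n y k                ≈⟨ +-congˡ (proj₂ preimage k) ⟩
      a * B (suc k) + r (suc k)                 ≈⟨ +-assoc _ _ _ ⟨
      a * B (suc k) + f (suc k) - a * B (suc k) ≈⟨ xyx⁻¹≈y _ _ ⟩
      f (suc k)                                 ∎

  Tseq-vanishesAt⁻¹ : ∀ {p} n x → VanishesAt p (Tseq n x) → ∀ i → parity (toℕ i) ≡ p → x i ≈ 0#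
  Tseq-vanishesAt⁻¹ n x van zero p≡0ℙ = trans (sym (Tseq-0 n x)) (van 0 p≡0ℙ)
  Tseq-vanishesAt⁻¹ {p} (suc n) x van (suc i) p[1+i]≡p = Tseq-vanishesAt⁻¹ n (tail x) tail-vanishes i
    (≡.sym (ℙₚ.⁻¹-selfInverse (≡.trans (≡.sym (parity-suc (toℕ i))) p[1+i]≡p)))
    where
    head-term : ∀ q {k} → q ≡ p → parity (suc k) ≡ q → head x * evenBinomial (suc n) (suc k) ≈ 0#
    head-term 0ℙ     0ℙ≡p _        =
      trans (*-congʳ (Tseq-vanishesAt⁻¹ (suc n) x van zero 0ℙ≡p)) (zeroˡ _)
    head-term 1ℙ {k} _    p[1+k]≡1 =
      trans (*-congˡ (evenBinomial-vanishesAt (suc n) (suc k) p[1+k]≡1)) (zeroʳ _)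
    tail-vanishes : VanishesAt (p ⁻¹) (Tseq n (tail x))
    tail-vanishes k pk≡p⁻¹ = begin
      Tseq n (tail x) k                                          ≈⟨ +-identityˡ _ ⟨
      0# + Tseq n (tail x) k                                     ≈⟨ +-congʳ (head-term p ≡.refl p[1+k]≡p) ⟨
      head x * evenBinomial (suc n) (suc k) + Tseq n (tail x) k ≈⟨ van (suc k) p[1+k]≡p ⟩
      0#                                                         ∎
      where p[1+k]≡p = ≡.trans (parity-suc k) (ℙₚ.⁻¹-selfInverse (≡.sym pk≡p⁻¹))

module _ {c ℓ} (F : Field c ℓ) where
  open Field F hiding (zero)
  open Polys F
  open Sequences ring
  open import Algebra.Properties.Semiring.Sum semiring using (sum; sum-cong-≋)
  open import Algebra.Properties.CommutativeSemigroup +-commutativeSemigroup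
    using () renaming (interchange to +-interchange)
  open SetoidReasoning setoid

  coeff-+P : ∀ p q k → coeff (p +P q) k ≈ coeff p k + coeff q k
  coeff-+P []      q       k       = sym (+-identityˡ _)
  coeff-+P (a ∷ p) []      k       = sym (+-identityʳ _)
  coeff-+P (a ∷ p) (b ∷ q) zero    = refl
  coeff-+P (a ∷ p) (b ∷ q) (suc k) = coeff-+P p q k

  coeff-·P : ∀ a p k → coeff (a ·P p) k ≈ a * coeff p k
  coeff-·P a []      k       = sym (zeroʳ a)
  coeff-·P a (b ∷ p) zero    = refl
  coeff-·P a (b ∷ p) (suc k) = coeff-·P a p k

  coeff-0∷ : ∀ p → coeff (0# ∷ p) ≈ₛ shift (coeff p)
  coeff-0∷ p zero    = refl
  coeff-0∷ p (suc k) = refl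

  coeff-∷*P : ∀ a p q → coeff ((a ∷ p) *P q) ≈ₛ λ k → a * coeff q k + shift (coeff (p *P q)) k
  coeff-∷*P a p q k =
    trans (coeff-+P (a ·P q) (0# ∷ (p *P q)) k) (+-cong (coeff-·P a q k) (coeff-0∷ (p *P q) k))

  coeff-0∷*P : ∀ p q → coeff ((0# ∷ p) *P q) ≈ₛ shift (coeff (p *P q))
  coeff-0∷*P p q k = trans (coeff-∷*P 0# p q k) (trans (+-congʳ (zeroˡ _)) (+-identityˡ _))

  coeff-*P-zeroˡ : ∀ p q → (∀ k → coeff p k ≈ 0#) → ∀ k → coeff (p *P q) k ≈ 0#
  coeff-*P-zeroˡ []      q p≈0 k = refl
  coeff-*P-zeroˡ (a ∷ p) q p≈0 k =
    trans (coeff-∷*P a p q k) (+-preserves-≈0 (trans (*-congʳ (p≈0 zero)) (zeroˡ _)) (tail≈0 k))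
    where
    tail≈0 : ∀ k → shift (coeff (p *P q)) k ≈ 0#
    tail≈0 zero    = refl
    tail≈0 (suc k) = coeff-*P-zeroˡ p q (p≈0 ∘ suc) k

  coeff-*P-congʳ : ∀ p p′ q → coeff p ≈ₛ coeff p′ → coeff (p *P q) ≈ₛ coeff (p′ *P q)
  coeff-*P-congʳ []      []       q p≈p′ = λ _ → refl
  coeff-*P-congʳ (a ∷ p) []       q p≈p′ = coeff-*P-zeroˡ (a ∷ p) q p≈p′
  coeff-*P-congʳ []      (b ∷ p′) q p≈p′ = λ k → sym (coeff-*P-zeroˡ (b ∷ p′) q (sym ∘ p≈p′) k)
  coeff-*P-congʳ (a ∷ p) (b ∷ p′) q p≈p′ k = begin
    coeff ((a ∷ p) *P q) k                  ≈⟨ coeff-∷*P a p q k ⟩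
    a * coeff q k + shift (coeff (p *P q)) k ≈⟨ +-cong (*-congʳ (p≈p′ zero))
                                                 (shift-cong (coeff-*P-congʳ p p′ q (p≈p′ ∘ suc)) k) ⟩
    b * coeff q k + shift (coeff (p′ *P q)) k ≈⟨ coeff-∷*P b p′ q k ⟨
    coeff ((b ∷ p′) *P q) k                 ∎

  coeff-+P-*P : ∀ p p′ q → coeff ((p +P p′) *P q) ≈ₛ λ k → coeff (p *P q) k + coeff (p′ *P q) k
  coeff-+P-*P []      p′       q k = sym (+-identityˡ _)
  coeff-+P-*P (a ∷ p) []       q k = sym (+-identityʳ _)
  coeff-+P-*P (a ∷ p) (b ∷ p′) q k = begin
    coeff (((a + b) ∷ (p +P p′)) *P q) k
      ≈⟨ coeff-∷*P (a + b) (p +P p′) q k ⟩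
    (a + b) * coeff q k + shift (coeff ((p +P p′) *P q)) k
      ≈⟨ +-cong (distribʳ _ a b) (shift-cong (coeff-+P-*P p p′ q) k) ⟩
    (a * coeff q k + b * coeff q k) + shift (λ j → coeff (p *P q) j + coeff (p′ *P q) j) k
      ≈⟨ +-congˡ (shift-+ k) ⟩
    (a * coeff q k + b * coeff q k) + (shift (coeff (p *P q)) k + shift (coeff (p′ *P q)) k)
      ≈⟨ +-interchange _ _ _ _ ⟩
    (a * coeff q k + shift (coeff (p *P q)) k) + (b * coeff q k + shift (coeff (p′ *P q)) k)
      ≈⟨ +-cong (coeff-∷*P a p q k) (coeff-∷*P b p′ q k) ⟨
    coeff ((a ∷ p) *P q) k + coeff ((b ∷ p′) *P q) k
      ∎
    where
    shift-+ : ∀ k → shift (λ j → coeff (p *P q) j + coeff (p′ *P q) j) k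
                    ≈ shift (coeff (p *P q)) k + shift (coeff (p′ *P q)) k
    shift-+ zero    = sym (+-identityʳ 0#)
    shift-+ (suc k) = refl

  coeff-oneP*P : ∀ q → coeff (oneP *P q) ≈ₛ coeff q
  coeff-oneP*P q k = trans (coeff-∷*P 1# [] q k) (trans (+-congʳ (*-identityˡ _)) (no-tail k))
    where
    no-tail : ∀ k → coeff q k + shift (λ _ → 0#) k ≈ coeff q k
    no-tail zero    = +-identityʳ _
    no-tail (suc k) = +-identityʳ _

  coeff-X*P : ∀ q → coeff (X *P q) ≈ₛ shift (coeff q)
  coeff-X*P q k = trans (coeff-0∷*P (1# ∷ []) q k) (shift-cong (coeff-oneP*P q) k)

  coeff-X^P*P : ∀ i q → coeff ((X ^P i) *P q) ≈ₛ shiftBy i (coeff q)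
  coeff-X^P*P zero    q = coeff-oneP*P q
  coeff-X^P*P (suc i) q k = begin
    coeff ((X *P (X ^P i)) *P q) k
      ≈⟨ coeff-*P-congʳ (X *P (X ^P i)) (0# ∷ (X ^P i)) q
           (λ j → trans (coeff-X*P (X ^P i) j) (sym (coeff-0∷ (X ^P i) j))) k ⟩
    coeff ((0# ∷ (X ^P i)) *P q) k  ≈⟨ coeff-0∷*P (X ^P i) q k ⟩
    shift (coeff ((X ^P i) *P q)) k ≈⟨ shift-cong (coeff-X^P*P i q) k ⟩
    shiftBy (suc i) (coeff q) k     ∎

  coeff-X^P : ∀ i → coeff (X ^P i) ≈ₛ monomial i
  coeff-X^P zero    zero    = refl
  coeff-X^P zero    (suc k) = refl
  coeff-X^P (suc i) k       = trans (coeff-X*P (X ^P i) k) (shift-cong (coeff-X^P i) k)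

  coeff-[X²+1]^P : ∀ j → coeff (((X ^P 2) +P oneP) ^P j) ≈ₛ evenBinomial j
  coeff-[X²+1]^P zero    zero    = refl
  coeff-[X²+1]^P zero    (suc k) = refl
  coeff-[X²+1]^P (suc j) k       = begin
    coeff ((X ^P 2 +P oneP) *P P) k
      ≈⟨ coeff-+P-*P (X ^P 2) oneP P k ⟩
    coeff (X ^P 2 *P P) k + coeff (oneP *P P) k
      ≈⟨ +-cong (coeff-X^P*P 2 P k) (coeff-oneP*P P k) ⟩
    shift (shift (coeff P)) k + coeff P k
      ≈⟨ +-cong (shift-cong (shift-cong (coeff-[X²+1]^P j)) k) (coeff-[X²+1]^P j k) ⟩
    evenBinomial (suc j) k
      ∎
    where P = (X ^P 2 +P oneP) ^P j

  coeff-∘PX² : ∀ p → coeff (p ∘P (X ^P 2)) ≈ₛ spread (coeff p)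
  coeff-∘PX² []      k = sym (spread-vanishes k)
    where
    spread-vanishes : ∀ k → spread (λ _ → 0#) k ≈ 0#
    spread-vanishes zero          = refl
    spread-vanishes (suc zero)    = refl
    spread-vanishes (suc (suc k)) = spread-vanishes k
  coeff-∘PX² (a ∷ p) k = trans (coeff-+P (a ∷ []) (X ^P 2 *P (p ∘P (X ^P 2))) k)
                               (trans (+-congˡ (coeff-X^P*P 2 (p ∘P (X ^P 2)) k)) (split k))
    where
    split : ∀ k → coeff (a ∷ []) k + shift (shift (coeff (p ∘P (X ^P 2)))) k
                  ≈ spread (coeff (a ∷ p)) k
    split zero          = +-identityʳ a
    split (suc zero)    = +-identityʳ 0#
    split (suc (suc k)) = trans (+-identityˡ _) (coeff-∘PX² p k)

  coeff-sumP : ∀ n f k → coeff (sumP n f) k ≈ sum (λ i → coeff (f i) k)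
  coeff-sumP zero    f k = sym (+-identityʳ _)
  coeff-sumP (suc n) f k = trans (coeff-+P (f zero) _ k) (+-congˡ (coeff-sumP n (f ∘ suc) k))

  coeff-toPoly : ∀ m z → coeff (toPoly m z) ≈ₛ toSeq m z
  coeff-toPoly m z k = trans (coeff-sumP m _ k) (sum-cong-≋ λ i →
    trans (coeff-·P (z i) (X ^P (m ∸ toℕ i)) k) (*-congˡ (coeff-X^P (m ∸ toℕ i) k)))

  coeff-T : ∀ n x → coeff (T n x) ≈ₛ Tseq n x
  coeff-T n x k = trans (coeff-sumP n _ k) (sum-cong-≋ λ i →
    trans (coeff-·P (x i) (X ^P toℕ i *P (X ^P 2 +P oneP) ^P (n ∸ toℕ i)) k)
          (*-congˡ (trans (coeff-X^P*P (toℕ i) _ k) (shiftBy-cong (toℕ i) (coeff-[X²+1]^P (n ∸ toℕ i)) k))))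

  coeff-S : ∀ n x → coeff (S (toPoly n x)) ≈ₛ spread (toSeq n x)
  coeff-S n x k = trans (coeff-∘PX² (toPoly n x) k) (spread-cong (coeff-toPoly n x) k)

  InW⇒symmetric : ∀ {m z} → InW m z → Symmetric m (toSeq m z)
  InW⇒symmetric {m} {z} w a b a+b≡m
    with ∸toℕ-onto (≡.subst (a ℕ.≤_) a+b≡m (ℕₚ.m≤m+n a b))
  ... | i , ≡.refl = begin
    toSeq m z (m ∸ toℕ i)            ≈⟨ fromSeq-toSeq m z i ⟩
    z i                              ≈⟨ w i ⟩
    z (opposite i)                   ≈⟨ fromSeq-toSeq m z (opposite i) ⟨
    toSeq m z (m ∸ toℕ (opposite i)) ≡⟨ ≡.cong (toSeq m z) (ℕₚ.+-cancelˡ-≡ (m ∸ toℕ i) _ _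
                                          (≡.trans (∸toℕ+∸toℕ-opposite i) (≡.sym a+b≡m))) ⟩
    toSeq m z b                      ∎

  symmetric⇒InW : ∀ {m f} → Symmetric m f → InW m (fromSeq m f)
  symmetric⇒InW sym-f i = sym-f _ _ (∸toℕ+∸toℕ-opposite i)

  InU⇒vanishesAt : ∀ {n z} → InU (2 ℕ.* n) z → VanishesAt 1ℙ (toSeq (2 ℕ.* n) z)
  InU⇒vanishesAt {n} {z} u k pk with k ℕₚ.≤? 2 ℕ.* n
  ... | no  k≰2n = toSeq-degree (2 ℕ.* n) z k (ℕₚ.≰⇒> k≰2n)
  ... | yes k≤2n with ∸toℕ-onto k≤2n
  ...   | i , ≡.refl = trans (fromSeq-toSeq (2 ℕ.* n) z i)
                             (u i (parity≡1ℙ⇒Odd (toℕ i) (≡.trans (≡.sym (parity-2n∸i n i)) pk)))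

  vanishesAt⇒InU : ∀ {n f} → VanishesAt 1ℙ f → InU (2 ℕ.* n) (fromSeq (2 ℕ.* n) f)
  vanishesAt⇒InU {n} van i odd = van _ (≡.trans (parity-2n∸i n i) (Odd⇒parity≡1ℙ (toℕ i) odd))

  isLinIso : ∀ {n m} {A : V n → Set ℓ} {B : V m → Set ℓ} (g : V n → Poly) (E : Fin (suc n) → Seq) →
             (∀ x → coeff (g x) ≈ₛ combination E x) →
             (∀ i → Degree≤ m (E i)) →
             (∀ x y → combination E x ≈ₛ combination E y → x ≈V y) →
             (∀ x → A x → B (fromPoly m (g x))) →
             (∀ z → B z → Σ[ x ∈ V n ] A x × combination E x ≈ₛ toSeq m z) →
             IsLinIso n m A B g
  isLinIso {n} {m} g E coeff-g E-degree E-injective maps onto =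
      (λ x Ax → degree x , maps x Ax)
    , (λ x y _ _ i → additive x y (m ∸ toℕ i))
    , (λ a x _ i → homogeneous a x (m ∸ toℕ i))
    , (λ x y _ _ gx≈gy → E-injective x y (fromSeq-injective (E-degree′ x) (E-degree′ y)
                           λ i → trans (sym (coeff-g x _)) (trans (gx≈gy i) (coeff-g y _))))
    , λ z Bz → let (x , Ax , Ex≈z) = onto z Bz in
               x , Ax , λ i → trans (coeff-g x _) (trans (Ex≈z _) (fromSeq-toSeq m z i))
    where
    E-degree′ = combination-degree E-degree
    degree : ∀ x → DegLe m (g x)
    degree x k m<k = trans (coeff-g x k) (E-degree′ x k m<k)
    additive : ∀ x y → coeff (g (x +V y)) ≈ₛ λ k → coeff (g x) k + coeff (g y) k
    additive x y k = trans (coeff-g (x +V y) k)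
                           (trans (combination-+ E x y k) (sym (+-cong (coeff-g x k) (coeff-g y k))))
    homogeneous : ∀ a x → coeff (g (a ·V x)) ≈ₛ λ k → a * coeff (g x) k
    homogeneous a x k = trans (coeff-g (a ·V x) k)
                              (trans (combination-* E a x k) (sym (*-congˡ (coeff-g x k))))

  module _ (n : ℕ) where
    spread-toSeq : ∀ x → spread (toSeq n x) ≈ₛ combination (spread ∘ monomialBasis n) x
    spread-toSeq = spread-combination (monomialBasis n)

    S-isLinIso : ∀ {A B} → (∀ x → A x → B (fromPoly (2 ℕ.* n) (S (toPoly n x)))) →
                 (∀ z → B z → Σ[ x ∈ V n ] A x × spread (toSeq n x) ≈ₛ toSeq (2 ℕ.* n) z) →
                 IsLinIso n (2 ℕ.* n) A B (S ∘ toPoly n)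
    S-isLinIso maps onto = isLinIso (S ∘ toPoly n) (spread ∘ monomialBasis n)
      (λ x k → trans (coeff-S n x k) (spread-toSeq x k))
      (λ i → Degree≤-mono (ℕₚ.*-monoʳ-≤ 2 (ℕₚ.m∸n≤m n (toℕ i)))
                          (spread-degree (monomial-degree (n ∸ toℕ i))))
      (λ x y Sx≈Sy → toSeq-injective n (spread-injective λ k →
                       trans (spread-toSeq x k) (trans (Sx≈Sy k) (sym (spread-toSeq y k)))))
      maps
      λ z Bz → let (x , Ax , Sx≈z) = onto z Bz in x , Ax , λ k → trans (sym (spread-toSeq x k)) (Sx≈z k)

    S-InU : ∀ x → InU (2 ℕ.* n) (fromPoly (2 ℕ.* n) (S (toPoly n x)))
    S-InU x = vanishesAt⇒InU {n} (vanishesAt-resp (sym ∘ coeff-S n x) (spread-vanishesAt (toSeq n x)))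

    S-InW : ∀ x → InW n x → InW (2 ℕ.* n) (fromPoly (2 ℕ.* n) (S (toPoly n x)))
    S-InW x w = symmetric⇒InW (symmetric-resp (sym ∘ coeff-S n x) (spread-symmetric (InW⇒symmetric w)))

    S-preimage : V (2 ℕ.* n) → V n
    S-preimage z = fromSeq n (evenPart (toSeq (2 ℕ.* n) z))

    S-preimage-image : ∀ z → InU (2 ℕ.* n) z → spread (toSeq n (S-preimage z)) ≈ₛ toSeq (2 ℕ.* n) z
    S-preimage-image z u k =
      trans (spread-cong (toSeq-fromSeq {n} (evenPart-degree {n} (toSeq-degree (2 ℕ.* n) z))) k)
            (spread-evenPart (InU⇒vanishesAt {n} u) k)

    S-V≅U : IsLinIso n (2 ℕ.* n) (InV n) (InU (2 ℕ.* n)) (S ∘ toPoly n)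
    S-V≅U = S-isLinIso (λ x _ → S-InU x) λ z u → S-preimage z , lift _ , S-preimage-image z u

    S-W≅W∩U : IsLinIso n (2 ℕ.* n) (InW n) (λ q → InW (2 ℕ.* n) q × InU (2 ℕ.* n) q) (S ∘ toPoly n)
    S-W≅W∩U = S-isLinIso (λ x w → S-InW x w , S-InU x) λ z (w , u) →
      S-preimage z , symmetric⇒InW (evenPart-symmetric (InW⇒symmetric w)) , S-preimage-image z u

    T-isLinIso : ∀ {A B} → (∀ x → A x → B (fromPoly (2 ℕ.* n) (T n x))) →
                 (∀ z → B z → Σ[ x ∈ V n ] A x × Tseq n x ≈ₛ toSeq (2 ℕ.* n) z) →
                 IsLinIso n (2 ℕ.* n) A B (T n)
    T-isLinIso = isLinIso (T n) (Tbasis n) (coeff-T n) (degree≤ ∘ Tbasis-palindromic n) (Tseq-injective n)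

    T-InW : ∀ x → InW (2 ℕ.* n) (fromPoly (2 ℕ.* n) (T n x))
    T-InW x = symmetric⇒InW (symmetric-resp (sym ∘ coeff-T n x) (symmetric (Tseq-palindromic n x)))

    T-InU : ∀ x → InU n x → InU (2 ℕ.* n) (fromPoly (2 ℕ.* n) (T n x))
    T-InU x u = vanishesAt⇒InU {n} (vanishesAt-resp (sym ∘ coeff-T n x)
      (Tseq-vanishesAt n x λ i pi≡1 → u i (parity≡1ℙ⇒Odd (toℕ i) pi≡1)))

    T-preimage : ∀ z → InW (2 ℕ.* n) z → Σ[ x ∈ V n ] Tseq n x ≈ₛ toSeq (2 ℕ.* n) z
    T-preimage z w = Tseq-surjective n (toSeq (2 ℕ.* n) z) record
      { degree≤   = toSeq-degree (2 ℕ.* n) z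
      ; symmetric = InW⇒symmetric w
      }

    T-preimage-InU : ∀ z w → InU (2 ℕ.* n) z → InU n (proj₁ (T-preimage z w))
    T-preimage-InU z w u i odd = Tseq-vanishesAt⁻¹ n (proj₁ (T-preimage z w))
      (vanishesAt-resp (sym ∘ proj₂ (T-preimage z w)) (InU⇒vanishesAt {n} u))
      i (Odd⇒parity≡1ℙ (toℕ i) odd)

    T-V≅W : IsLinIso n (2 ℕ.* n) (InV n) (InW (2 ℕ.* n)) (T n)
    T-V≅W = T-isLinIso (λ x _ → T-InW x) λ z w → proj₁ (T-preimage z w) , lift _ , proj₂ (T-preimage z w)

    T-U≅W∩U : IsLinIso n (2 ℕ.* n) (InU n) (λ q → InW (2 ℕ.* n) q × InU (2 ℕ.* n) q) (T n)
    T-U≅W∩U = T-isLinIso (λ x u → T-InW x , T-InU x u) λ z (w , u) →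
      proj₁ (T-preimage z w) , T-preimage-InU z w u , proj₂ (T-preimage z w)

open import Data.Nat.Base using (_*_)

lemma2p6 : ∀ {c ℓ : Level} (F : Field c ℓ) (n : ℕ) → let open Polys F in
    IsLinIso n (2 * n) (InV n) (InU (2 * n)) (λ p → S (toPoly n p))
    × IsLinIso n (2 * n) (InW n) (λ q → InW (2 * n) q × InU (2 * n) q) (λ p → S (toPoly n p))
    × IsLinIso n (2 * n) (InV n) (InW (2 * n)) (T n)
    × IsLinIso n (2 * n) (InU n) (λ q → InW (2 * n) q × InU (2 * n) q) (T n)
lemma2p6 F n = S-V≅U F n , S-W≅W∩U F n , T-V≅W F n , T-U≅W∩U F n
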